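{- For a finite rooted planar tree $T$ let $\gamma(T)$ be the number of grafted trees with skeleton $T$ and $\tilde\gamma(T)$ the number of morphisms $T\to\{1,2\}$ (so $\gamma(\{r\})=1$, $\tilde\gamma(\{r\})=2$ for the trivial tree). If $T$ is non-trivial and $T_1,\dots,T_k$ are the principal subtrees defined by the $k$ sons $s_1,\dots,s_k$ of the root of $T$, then $$\gamma(T)=1+\prod_{i=1}^k\gamma(T_i)\qquad\text{and}\qquad \tilde\gamma(T)=1+\prod_{i=1}^k\tilde\gamma(T_i).$$
   Context: A finite rooted planar tree has a root $r$, edges oriented away from the root (from father $\alpha(e)$ to son $\omega(e)$), and totally ordered sons at each vertex; leaves have no sons; the tree $\{r\}$ is trivial. The principal subtree $T(s_i)$ consists of the son $s_i$ of the root and all its descendants, rooted at $s_i$. $\{1,2\}$ is totally ordered with $1<2$; a morphism $\mu:T\to\{1,2\}$ is a map on vertices with $\mu(\omega(e))\ge\mu(\alpha(e))$ for every edge $e$. A grafted tree is a tuple $(A;B_1,\dots,B_{d(A)})$ of finite rooted planar trees, $A$ having $d(A)$ leaves; its skeleton is obtained by gluing the root of $B_i$ onto the $i$-th leaf of $A$ (leaves ordered from left to right), $i=1,\dots,d(A)$. -}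

module Defs where

open import Data.Nat using (ℕ; _+_)
open import Data.List using (List; []; _∷_)
open import Data.List.Relation.Unary.All using (All)
open import Data.Vec using (Vec; []; _∷_; take; drop)
open import Data.Fin using (Fin)
open import Data.Product using (Σ; Σ-syntax)
open import Function.Bundles using (_↔_)
open import Relation.Binary.PropositionalEquality using (_≡_)

-- Finite rooted planar trees: a vertex together with its ordered list of sons.
-- The trivial tree {r} is  node [] .  The principal subtrees of  node ts
-- are the elements of  ts  (in order).
data Tree : Set where
  node : List Tree → Tree

mutual
  leaves : Tree → ℕ
  leaves (node [])       = 1
  leaves (node (t ∷ ts)) = leavesF (t ∷ ts)

  leavesF : List Tree → ℕ
  leavesF []       = 0
  leavesF (t ∷ ts) = leaves t + leavesF ts

-- Skeleton of a grafted tree (A; B_1, …, B_d(A)): glue the root of B_i onto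
-- the i-th leaf of A (leaves ordered left to right).
mutual
  graft : (A : Tree) → Vec Tree (leaves A) → Tree
  graft (node [])       (B ∷ []) = B
  graft (node (t ∷ ts)) Bs       = node (graftF (t ∷ ts) Bs)

  graftF : (ts : List Tree) → Vec Tree (leavesF ts) → List Tree
  graftF []       []  = []
  graftF (t ∷ ts) Bs  = graft t (take (leaves t) Bs) ∷ graftF ts (drop (leaves t) Bs)

GraftedWithSkeleton : Tree → Set
GraftedWithSkeleton T = Σ[ A ∈ Tree ] Σ[ Bs ∈ Vec Tree (leaves A) ] graft A Bs ≡ T

data Two : Set where
  one two : Two

data _≤₂_ : Two → Two → Set where
  one≤one : one ≤₂ one
  one≤two : one ≤₂ two
  two≤two : two ≤₂ two

-- MorGE a T : a vertex map μ : T → {1,2} that is monotone along every edge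
-- and whose value at the root is ≥ a.
data MorGE (a : Two) : Tree → Set where
  mk : ∀ {ts} (b : Two) → a ≤₂ b → All (MorGE b) ts → MorGE a (node ts)

-- Morphisms T → {1,2} (the root-lower-bound 1 is no constraint)
Morphism : Tree → Set
Morphism T = MorGE one T

HasCard : Set → ℕ → Set
HasCard X n = X ↔ Fin n

{-# OPTIONS --safe #-}
module Submission where

-- Both counts split according to the root.  A grafted tree with skeleton
-- node ts either has trivial A (and then B₁ = node ts), or A = node as with
-- as and ts of the same length, and then it is the list of grafted trees
-- (aᵢ; consecutive block of Bs) with skeletons the principal subtrees tᵢ.
-- A morphism either sends the root to 1, leaving independent morphisms on
-- the principal subtrees, or sends it to 2, which forces the constant map 2.

open import Defs
open import Data.Nat using (ℕ; _+_)
open import Data.List using (List; []; _∷_)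
open import Data.List.Properties using (∷-dec; ∷-injectiveˡ; ∷-injectiveʳ)
open import Data.List.Relation.Unary.All using (All; []; _∷_)
open import Data.List.Relation.Binary.Pointwise using (Pointwise; []; _∷_)
open import Data.Nat.ListAction using (product)
open import Data.Vec using (Vec; []; _∷_; take; drop; _++_)
open import Data.Vec.Properties using (take++drop≡id)
open import Data.Fin.Properties using (1↔⊤; +↔⊎; *↔×)
open import Data.Product using (_×_; Σ-syntax; _,_)
open import Data.Product.Function.NonDependent.Propositional using (_×-↔_)
open import Data.Sum using (_⊎_; inj₁; inj₂)
open import Data.Sum.Function.Propositional using (_⊎-↔_)
open import Data.Unit using (⊤; tt)
open import Function.Bundles using (_↔_; mk↔ₛ′)
open import Function.Properties.Inverse using (↔-refl; ↔-sym; ↔-trans)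
open import Relation.Binary.Definitions using (DecidableEquality)
open import Relation.Binary.PropositionalEquality using (_≡_; refl; cong; cong₂; trans)
open import Relation.Nullary.Decidable using (yes; no; map′)
open import Axiom.UniquenessOfIdentityProofs using (UIP; module Decidable⇒UIP)

private
  variable
    A : Set
    X : Set
    m n : ℕ

node-injective : ∀ {ts us} → node ts ≡ node us → ts ≡ us
node-injective refl = refl

mutual
  _≟_ : DecidableEquality Tree
  node ts ≟ node us = map′ (cong node) node-injective (ts ≟ₗ us)

  _≟ₗ_ : DecidableEquality (List Tree)
  []       ≟ₗ []       = yes refl
  []       ≟ₗ (_ ∷ _)  = no λ ()
  (_ ∷ _)  ≟ₗ []       = no λ ()
  (t ∷ ts) ≟ₗ (u ∷ us) = ∷-dec (t ≟ u) (ts ≟ₗ us)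

-- Grafted trees carry a proof of graft A Bs ≡ T; Hedberg's theorem makes it
-- irrelevant without appealing to K.
uip : UIP Tree
uip = Decidable⇒UIP.≡-irrelevant _≟_

uipₗ : UIP (List Tree)
uipₗ = Decidable⇒UIP.≡-irrelevant _≟ₗ_

take-++ : (xs : Vec A m) (ys : Vec A n) → take m (xs ++ ys) ≡ xs
take-++ []       ys = refl
take-++ (x ∷ xs) ys = cong (x ∷_) (take-++ xs ys)

drop-++ : (xs : Vec A m) (ys : Vec A n) → drop m (xs ++ ys) ≡ ys
drop-++ []       ys = refl
drop-++ (x ∷ xs) ys = drop-++ xs ys

HasCard-⊤⊎ : HasCard X n → HasCard (⊤ ⊎ X) (1 + n)
HasCard-⊤⊎ X↔n = ↔-trans (↔-refl ⊎-↔ X↔n) (↔-sym (↔-trans +↔⊎ (1↔⊤ ⊎-↔ ↔-refl)))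

All-[]↔⊤ : {P : A → Set} → All P [] ↔ ⊤
All-[]↔⊤ = mk↔ₛ′ (λ _ → tt) (λ _ → []) (λ _ → refl) (λ { [] → refl })

All-∷↔× : {P : A → Set} {x : A} {xs : List A} → All P (x ∷ xs) ↔ (P x × All P xs)
All-∷↔× = mk↔ₛ′ (λ { (p ∷ ps) → p , ps }) (λ { (p , ps) → p ∷ ps })
                (λ _ → refl) (λ { (p ∷ ps) → refl })

HasCard-All : {P : A → Set} {xs : List A} {ns : List ℕ} →
              Pointwise (λ x n → HasCard (P x) n) xs ns → HasCard (All P xs) (product ns)
HasCard-All []       = ↔-trans All-[]↔⊤ (↔-sym 1↔⊤)
HasCard-All (c ∷ cs) = ↔-trans All-∷↔× (↔-trans (c ×-↔ HasCard-All cs) (↔-sym *↔×))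

GraftedForestWithSkeleton : List Tree → Set
GraftedForestWithSkeleton ts =
  Σ[ As ∈ List Tree ] Σ[ Bs ∈ Vec Tree (leavesF As) ] graftF As Bs ≡ ts

grafted-≡ : ∀ {T A} {Bs Bs′ : Vec Tree (leaves A)} {e : graft A Bs ≡ T} {e′ : graft A Bs′ ≡ T} →
            Bs ≡ Bs′ → _≡_ {A = GraftedWithSkeleton T} (A , Bs , e) (A , Bs′ , e′)
grafted-≡ {e = e} {e′} refl = cong (λ e″ → _ , _ , e″) (uip e e′)

graftedForest-≡ : ∀ {ts As} {Bs Bs′ : Vec Tree (leavesF As)}
                    {e : graftF As Bs ≡ ts} {e′ : graftF As Bs′ ≡ ts} →
                  Bs ≡ Bs′ → _≡_ {A = GraftedForestWithSkeleton ts} (As , Bs , e) (As , Bs′ , e′)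
graftedForest-≡ {e = e} {e′} refl = cong (λ e″ → _ , _ , e″) (uipₗ e e′)

graftedForest-[]↔All : GraftedForestWithSkeleton [] ↔ All GraftedWithSkeleton []
graftedForest-[]↔All = mk↔ₛ′ (λ _ → []) (λ _ → [] , [] , refl) (λ { [] → refl }) from∘to
  where
  from∘to : (F : GraftedForestWithSkeleton []) → ([] , [] , refl) ≡ F
  from∘to ([] , [] , refl) = refl
  from∘to ((_ ∷ _) , _ , ())

graftedForest-∷↔× : ∀ t ts →
  GraftedForestWithSkeleton (t ∷ ts) ↔ (GraftedWithSkeleton t × GraftedForestWithSkeleton ts)
graftedForest-∷↔× t ts = mk↔ₛ′ to from to∘from from∘to
  where
  to : GraftedForestWithSkeleton (t ∷ ts) → GraftedWithSkeleton t × GraftedForestWithSkeleton ts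
  to ([] , [] , ())
  to ((A ∷ As) , Bs , e) =
    (A , take (leaves A) Bs , ∷-injectiveˡ e) , (As , drop (leaves A) Bs , ∷-injectiveʳ e)

  from : GraftedWithSkeleton t × GraftedForestWithSkeleton ts → GraftedForestWithSkeleton (t ∷ ts)
  from ((A , Bs , e) , (As , Bs′ , e′)) =
    (A ∷ As) , Bs ++ Bs′ , cong₂ _∷_ (trans (cong (graft A) (take-++ Bs Bs′)) e)
                                     (trans (cong (graftF As) (drop-++ Bs Bs′)) e′)

  to∘from : ∀ p → to (from p) ≡ p
  to∘from ((A , Bs , e) , (As , Bs′ , e′)) =
    cong₂ _,_ (grafted-≡ (take-++ Bs Bs′)) (graftedForest-≡ (drop-++ Bs Bs′))

  from∘to : ∀ F → from (to F) ≡ F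
  from∘to ([] , [] , ())
  from∘to ((A ∷ As) , Bs , e) = graftedForest-≡ (take++drop≡id (leaves A) Bs)

graftedForest↔All : ∀ ts → GraftedForestWithSkeleton ts ↔ All GraftedWithSkeleton ts
graftedForest↔All []       = graftedForest-[]↔All
graftedForest↔All (t ∷ ts) =
  ↔-trans (graftedForest-∷↔× t ts) (↔-trans (↔-refl ×-↔ graftedForest↔All ts) (↔-sym All-∷↔×))

grafted-node↔ : ∀ t ts →
  GraftedWithSkeleton (node (t ∷ ts)) ↔ (⊤ ⊎ GraftedForestWithSkeleton (t ∷ ts))
grafted-node↔ t ts = mk↔ₛ′ to from to∘from from∘to
  where
  to : GraftedWithSkeleton (node (t ∷ ts)) → ⊤ ⊎ GraftedForestWithSkeleton (t ∷ ts)
  to (node []       , _  , _) = inj₁ tt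
  to (node (A ∷ As) , Bs , e) = inj₂ ((A ∷ As) , Bs , node-injective e)

  from : ⊤ ⊎ GraftedForestWithSkeleton (t ∷ ts) → GraftedWithSkeleton (node (t ∷ ts))
  from (inj₁ tt)                    = node [] , node (t ∷ ts) ∷ [] , refl
  from (inj₂ ([] , [] , ()))
  from (inj₂ ((A ∷ As) , Bs , e))   = node (A ∷ As) , Bs , cong node e

  to∘from : ∀ x → to (from x) ≡ x
  to∘from (inj₁ tt)                  = refl
  to∘from (inj₂ ([] , [] , ()))
  to∘from (inj₂ ((A ∷ As) , Bs , e)) = cong inj₂ (graftedForest-≡ {As = A ∷ As} refl)

  from∘to : ∀ G → from (to G) ≡ G
  from∘to (node []       , B ∷ [] , refl) = refl
  from∘to (node (A ∷ As) , Bs     , e)    = grafted-≡ {A = node (A ∷ As)} refl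

mutual
  constTwo : ∀ t → MorGE two t
  constTwo (node ts) = mk two two≤two (constTwoAll ts)

  constTwoAll : ∀ ts → All (MorGE two) ts
  constTwoAll []       = []
  constTwoAll (t ∷ ts) = constTwo t ∷ constTwoAll ts

mutual
  constTwo-unique : ∀ {t} (μ : MorGE two t) → constTwo t ≡ μ
  constTwo-unique (mk two two≤two μs) = cong (mk two two≤two) (constTwoAll-unique μs)

  constTwoAll-unique : ∀ {ts} (μs : All (MorGE two) ts) → constTwoAll ts ≡ μs
  constTwoAll-unique []       = refl
  constTwoAll-unique (μ ∷ μs) = cong₂ _∷_ (constTwo-unique μ) (constTwoAll-unique μs)

morphism-node↔ : ∀ ts → Morphism (node ts) ↔ (⊤ ⊎ All Morphism ts)
morphism-node↔ ts = mk↔ₛ′ to from to∘from from∘to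
  where
  to : Morphism (node ts) → ⊤ ⊎ All Morphism ts
  to (mk one one≤one μs) = inj₂ μs
  to (mk two one≤two _)  = inj₁ tt

  from : ⊤ ⊎ All Morphism ts → Morphism (node ts)
  from (inj₁ tt) = mk two one≤two (constTwoAll ts)
  from (inj₂ μs) = mk one one≤one μs

  to∘from : ∀ x → to (from x) ≡ x
  to∘from (inj₁ tt) = refl
  to∘from (inj₂ μs) = refl

  from∘to : ∀ μ → from (to μ) ≡ μ
  from∘to (mk one one≤one μs) = refl
  from∘to (mk two one≤two μs) = cong (mk two one≤two) (constTwoAll-unique μs)

proposition7p2 : (s : Tree) (ss : List Tree)
    → ((gs : List ℕ) → Pointwise (λ t g → HasCard (GraftedWithSkeleton t) g) (s ∷ ss) gs
        → HasCard (GraftedWithSkeleton (node (s ∷ ss))) (1 + product gs))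
    × ((hs : List ℕ) → Pointwise (λ t h → HasCard (Morphism t) h) (s ∷ ss) hs
        → HasCard (Morphism (node (s ∷ ss))) (1 + product hs))
proposition7p2 s ss =
    (λ _ γs → ↔-trans (grafted-node↔ s ss)
                (HasCard-⊤⊎ (↔-trans (graftedForest↔All (s ∷ ss)) (HasCard-All γs))))
  , (λ _ γ̃s → ↔-trans (morphism-node↔ (s ∷ ss)) (HasCard-⊤⊎ (HasCard-All γ̃s)))
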